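{- Let $k > 1$ be an integer and $p$ a prime. Suppose $A = \{a_1, \ldots, a_n\} \subseteq \mathbb{Z}_p$ and let $\mathcal{L}_1, \mathcal{L}_2 \subset \mathbb{Z}[x_1, \ldots, x_n]$ be collections of $k$-bounded linear polynomials such that every $f \in \mathcal{L}_1$ satisfies $f(a_1, \ldots, a_n)=0$ in $\mathbb{Z}_p$, and every $f \in \mathcal{L}_2$ satisfies $f(a_1,\ldots,a_n)\neq 0$ in $\mathbb{Z}_p$. If $|A| < \log_k p - 1$, then there exist $b_1, \ldots, b_n \in \mathbb{Z}_{(p)}$ such that the canonical homomorphism $\mathbb{Z}_{(p)} \rightarrow \mathbb{Z}_p$ maps $b_i$ to $a_i$ for each $i$, $f(b_1, \ldots, b_n) = 0$ for every $f \in \mathcal{L}_1$, and $f(b_1, \ldots, b_n) \neq 0$ for every $f \in \mathcal{L}_2$.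
   Context: $\mathbb{Z}_p$ is the ring of integers modulo $p$ and $\mathbb{Z}_{(p)}$ is the localization of $\mathbb{Z}$ at $(p)$, i.e. the ring of rationals whose denominator is not divisible by $p$. A $k$-bounded linear polynomial is a polynomial $f\in\mathbb{Z}[x_1,\ldots,x_n]$ of degree at most $1$ (a non-zero constant term is allowed) whose coefficients, including the constant term, have absolute values summing to at most $k$. -}

module Defs where

open import Data.Nat as ℕ using (ℕ; zero; suc)
open import Data.Nat.Divisibility as ℕD using ()
open import Data.Integer as ℤ using (ℤ; +_)
open import Data.Integer.Divisibility as ℤD using ()
open import Data.Rational as ℚ using (ℚ)
open import Data.Fin using (Fin; toℕ)
import Data.Fin as Fin
open import Relation.Nullary using (¬_)

∑ℕ : (n : ℕ) → (Fin n → ℕ) → ℕ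
∑ℕ zero    f = 0
∑ℕ (suc n) f = f Fin.zero ℕ.+ ∑ℕ n (λ i → f (Fin.suc i))

∑ℤ : (n : ℕ) → (Fin n → ℤ) → ℤ
∑ℤ zero    f = + 0
∑ℤ (suc n) f = f Fin.zero ℤ.+ ∑ℤ n (λ i → f (Fin.suc i))

∑ℚ : (n : ℕ) → (Fin n → ℚ) → ℚ
∑ℚ zero    f = ℚ.0ℚ
∑ℚ (suc n) f = f Fin.zero ℚ.+ ∑ℚ n (λ i → f (Fin.suc i))

-- A polynomial in ℤ[x₁,…,xₙ] of degree at most 1:
-- f = const + ∑ᵢ coeff i · xᵢ
record LinPoly (n : ℕ) : Set where
  constructor linPoly
  field
    const : ℤ
    coeff : Fin n → ℤ
open LinPoly public

KBounded : {n : ℕ} → ℕ → LinPoly n → Set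
KBounded {n} k f = ℤ.∣ const f ∣ ℕ.+ ∑ℕ n (λ i → ℤ.∣ coeff f i ∣) ℕ.≤ k

evalℤ : {n : ℕ} → LinPoly n → (Fin n → ℤ) → ℤ
evalℤ {n} f x = const f ℤ.+ ∑ℤ n (λ i → coeff f i ℤ.* x i)

evalℚ : {n : ℕ} → LinPoly n → (Fin n → ℚ) → ℚ
evalℚ {n} f x = ℚ._/_ (const f) 1 ℚ.+ ∑ℚ n (λ i → ℚ._/_ (coeff f i) 1 ℚ.* x i)

-- ℤ_p is represented by Fin p (residues 0,…,p-1).
-- f(a₁,…,aₙ) = 0 in ℤ_p: the integer value at the residues is divisible by p
-- (ℤ → ℤ_p is a ring homomorphism).
VanishesModP : {n : ℕ} → (p : ℕ) → LinPoly n → (Fin n → Fin p) → Set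
VanishesModP p f a = (+ p) ℤD.∣ evalℤ f (λ i → + toℕ (a i))

-- ℤ_(p): rationals whose (reduced) denominator is not divisible by p.
InLocalization : ℕ → ℚ → Set
InLocalization p q = ¬ (p ℕD.∣ ℚ.denominatorℕ q)

-- The canonical homomorphism ℤ_(p) → ℤ_p sends u/d to u·d⁻¹ mod p;
-- it sends q to a iff u ≡ a·d (mod p).
MapsTo : (p : ℕ) → ℚ → Fin p → Set
MapsTo p q a = (+ p) ℤD.∣ (ℚ.numerator q ℤ.- (+ toℕ a) ℤ.* ℚ.denominator q)

-- The argument is simultaneous Dirichlet approximation modulo p.  Put K = k^n and
-- M = ⌊(p-1)/k⌋, so that K ≤ M, k·M < p and [0,p) is covered by k buckets of width M+1.
-- By the pigeonhole principle two multipliers u' < u ≤ K send every residue u·aᵢ mod p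
-- into the same bucket; hence d = u - u' satisfies 0 < d ≤ M and the integers
-- yᵢ = (u·aᵢ mod p) - (u'·aᵢ mod p) satisfy |yᵢ| ≤ M and yᵢ ≡ d·aᵢ (mod p).
-- We take bᵢ = yᵢ/d.  Since 0 < d < p, bᵢ lies in ℤ_(p) and reduces to aᵢ.  For a
-- k-bounded f the integer d·f(b) = f₀·d + ∑ fᵢyᵢ is congruent to d·f(a) modulo p and
-- has absolute value at most k·M < p, so it vanishes exactly when p ∣ f(a).
--
-- Congruences are stated with signed divisibility on ℤ, which has the closure lemmas;
-- the definitions of the statement use the unsigned one, converted by ∣ᵤ⇒∣ and ∣⇒∣ᵤ.
module Submission where

open import Defs
open import Data.Nat using (ℕ; _<_; _^_; _+_)
open import Data.Nat.Primality using (Prime)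
open import Data.Fin using (Fin)
open import Data.Rational using (ℚ; 0ℚ)
open import Data.Product using (Σ; _×_)
open import Function.Definitions using (Injective)
open import Relation.Binary.PropositionalEquality using (_≡_; _≢_)
open import Relation.Nullary using (¬_)

import Data.Nat as ℕ
open import Data.Nat using (zero; suc; pred; _∸_; _≤_; z≤n; NonZero; >-nonZero)
import Data.Nat.Properties as ℕP
open import Data.Nat.DivMod using (_/_; _%_; m%n<n; m≡m%n+[m/n]*n; m/n*n≤m; m*n/n≡m; /-monoˡ-≤; m<n*o⇒m/o<n)
import Data.Nat.Divisibility as ℕD
open import Data.Nat.Primality using (euclidsLemma; prime⇒nonZero)
open import Data.Integer as ℤ using (ℤ; +_)
import Data.Integer.Properties as ℤP
import Data.Integer.Divisibility as ℤD
open import Data.Integer.Divisibility.Signed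
  using (_∣_; divides; ∣-refl; ∣ᵤ⇒∣; ∣⇒∣ᵤ; ∣m∣n⇒∣m+n; ∣m∣n⇒∣m-n; ∣n⇒∣m*n; ∣m⇒∣-m)
open import Data.Integer.GCD using (gcd)
open import Data.Integer.Tactic.RingSolver using (solve-∀)
import Data.Rational as ℚ
import Data.Rational.Properties as ℚP
import Data.Rational.Unnormalised as ℚᵘ
import Data.Rational.Unnormalised.Properties as ℚᵘP
open ℚᵘ using (_≃_; *≡*)
import Data.Fin as Fin
import Data.Fin.Properties as FinP
open import Data.Product using (_,_)
open import Data.Sum using ([_,_]′)
open import Data.Empty using (⊥-elim)
open import Function using (_∘_; id)
open import Relation.Binary.PropositionalEquality
  using (refl; sym; trans; cong; cong₂; subst; module ≡-Reasoning)

∣-≡ : ∀ {m x y} → m ∣ x → x ≡ y → m ∣ y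
∣-≡ m∣x refl = m∣x

∣∧<⇒≡0 : ∀ {p m} → p ℕD.∣ m → m < p → m ≡ 0
∣∧<⇒≡0 {m = zero}  _   _   = refl
∣∧<⇒≡0 {m = suc m} p∣m m<p = ⊥-elim (ℕP.<⇒≱ m<p (ℕD.∣⇒≤ p∣m))

∑ℤ-congruence : ∀ {m} n (c y z : Fin n → ℤ) (D : ℤ) →
  (∀ i → m ∣ y i ℤ.- D ℤ.* z i) →
  m ∣ ∑ℤ n (λ i → c i ℤ.* y i) ℤ.- D ℤ.* ∑ℤ n (λ i → c i ℤ.* z i)
∑ℤ-congruence {m} zero c y z D _ = divides (+ 0) (vanish D m)
  where
  vanish : ∀ D m → + 0 ℤ.- D ℤ.* + 0 ≡ + 0 ℤ.* m
  vanish = solve-∀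
∑ℤ-congruence (suc n) c y z D y≡Dz =
  ∣-≡ (∣m∣n⇒∣m+n (∣n⇒∣m*n (c Fin.zero) (y≡Dz Fin.zero))
                 (∑ℤ-congruence n (c ∘ Fin.suc) (y ∘ Fin.suc) (z ∘ Fin.suc) D (y≡Dz ∘ Fin.suc)))
      (regroup (c Fin.zero) (y Fin.zero) (z Fin.zero) D _ _)
  where
  regroup : ∀ c₀ y₀ z₀ D S T →
    c₀ ℤ.* (y₀ ℤ.- D ℤ.* z₀) ℤ.+ (S ℤ.- D ℤ.* T) ≡ (c₀ ℤ.* y₀ ℤ.+ S) ℤ.- D ℤ.* (c₀ ℤ.* z₀ ℤ.+ T)
  regroup = solve-∀

∑ℤ-bound : ∀ n (c y : Fin n → ℤ) M → (∀ i → ℤ.∣ y i ∣ ≤ M) →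
  ℤ.∣ ∑ℤ n (λ i → c i ℤ.* y i) ∣ ≤ ∑ℕ n (λ i → ℤ.∣ c i ∣) ℕ.* M
∑ℤ-bound zero c y M _ = z≤n
∑ℤ-bound (suc n) c y M y≤M = begin
  ℤ.∣ c₀ ℤ.* y₀ ℤ.+ S ∣                ≤⟨ ℤP.∣i+j∣≤∣i∣+∣j∣ (c₀ ℤ.* y₀) S ⟩
  ℤ.∣ c₀ ℤ.* y₀ ∣ + ℤ.∣ S ∣            ≡⟨ cong (_+ ℤ.∣ S ∣) (ℤP.abs-* c₀ y₀) ⟩
  ℤ.∣ c₀ ∣ ℕ.* ℤ.∣ y₀ ∣ + ℤ.∣ S ∣      ≤⟨ ℕP.+-mono-≤ (ℕP.*-monoʳ-≤ ℤ.∣ c₀ ∣ (y≤M Fin.zero))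
                                            (∑ℤ-bound n (c ∘ Fin.suc) (y ∘ Fin.suc) M (y≤M ∘ Fin.suc)) ⟩
  ℤ.∣ c₀ ∣ ℕ.* M + Σ∣c∣ ℕ.* M          ≡⟨ ℕP.*-distribʳ-+ M ℤ.∣ c₀ ∣ Σ∣c∣ ⟨
  (ℤ.∣ c₀ ∣ + Σ∣c∣) ℕ.* M              ∎
  where
  open ℕP.≤-Reasoning
  c₀ = c Fin.zero
  y₀ = y Fin.zero
  S = ∑ℤ n (λ i → c (Fin.suc i) ℤ.* y (Fin.suc i))
  Σ∣c∣ = ∑ℕ n (λ i → ℤ.∣ c (Fin.suc i) ∣)

-- The homogenisation of f with weight d, evaluated at y: f₀·d + ∑ fᵢyᵢ, i.e. d·f(y/d).
homEval : ∀ {n} → LinPoly n → ℕ → (Fin n → ℤ) → ℤ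
homEval {n} f d y = const f ℤ.* + d ℤ.+ ∑ℤ n (λ i → coeff f i ℤ.* y i)

homEval-congruence : ∀ {m n} (f : LinPoly n) d (y a : Fin n → ℤ) →
  (∀ i → m ∣ y i ℤ.- + d ℤ.* a i) → m ∣ homEval f d y ℤ.- + d ℤ.* evalℤ f a
homEval-congruence {n = n} f d y a y≡da =
  ∣-≡ (∑ℤ-congruence n (coeff f) y a (+ d) y≡da) (regroup (const f) (+ d) _ _)
  where
  regroup : ∀ c D S T → S ℤ.- D ℤ.* T ≡ (c ℤ.* D ℤ.+ S) ℤ.- D ℤ.* (c ℤ.+ T)
  regroup = solve-∀

homEval-bound : ∀ {k n} (f : LinPoly n) {d M} (y : Fin n → ℤ) → KBounded k f → d ≤ M →
  (∀ i → ℤ.∣ y i ∣ ≤ M) → ℤ.∣ homEval f d y ∣ ≤ k ℕ.* M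
homEval-bound {k} {n} f {d} {M} y kb d≤M y≤M = begin
  ℤ.∣ const f ℤ.* + d ℤ.+ S ∣      ≤⟨ ℤP.∣i+j∣≤∣i∣+∣j∣ (const f ℤ.* + d) S ⟩
  ℤ.∣ const f ℤ.* + d ∣ + ℤ.∣ S ∣  ≡⟨ cong (_+ ℤ.∣ S ∣) (ℤP.abs-* (const f) (+ d)) ⟩
  ∣c∣ ℕ.* d + ℤ.∣ S ∣              ≤⟨ ℕP.+-mono-≤ (ℕP.*-monoʳ-≤ ∣c∣ d≤M) (∑ℤ-bound n (coeff f) y M y≤M) ⟩
  ∣c∣ ℕ.* M + Σ∣c∣ ℕ.* M           ≡⟨ ℕP.*-distribʳ-+ M ∣c∣ Σ∣c∣ ⟨
  (∣c∣ + Σ∣c∣) ℕ.* M               ≤⟨ ℕP.*-monoˡ-≤ M kb ⟩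
  k ℕ.* M                          ∎
  where
  open ℕP.≤-Reasoning
  S = ∑ℤ n (λ i → coeff f i ℤ.* y i)
  ∣c∣ = ℤ.∣ const f ∣
  Σ∣c∣ = ∑ℕ n (λ i → ℤ.∣ coeff f i ∣)

small-congruent-zero : ∀ {p} d H E → + p ∣ H ℤ.- + d ℤ.* E → ℤ.∣ H ∣ < p → + p ℤD.∣ E → H ≡ + 0
small-congruent-zero {p} d H E p∣H-dE ∣H∣<p p∣E = ℤP.∣i∣≡0⇒i≡0 (∣∧<⇒≡0 (∣⇒∣ᵤ p∣H) ∣H∣<p)
  where
  cancel : ∀ H D E → (H ℤ.- D ℤ.* E) ℤ.+ D ℤ.* E ≡ H
  cancel = solve-∀
  p∣H : + p ∣ H
  p∣H = ∣-≡ (∣m∣n⇒∣m+n p∣H-dE (∣n⇒∣m*n (+ d) (∣ᵤ⇒∣ p∣E))) (cancel H (+ d) E)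

zero-congruent⇒∣ : ∀ {p} d H E → Prime p → ¬ p ℕD.∣ d → + p ∣ H ℤ.- + d ℤ.* E → H ≡ + 0 →
  + p ℤD.∣ E
zero-congruent⇒∣ {p} d .(+ 0) E pr p∤d p∣H-dE refl = [ ⊥-elim ∘ p∤d , id ]′ (euclidsLemma d ℤ.∣ E ∣ pr p∣dE)
  where
  negate : ∀ D E → ℤ.- (+ 0 ℤ.- D ℤ.* E) ≡ D ℤ.* E
  negate = solve-∀
  p∣dE : p ℕD.∣ d ℕ.* ℤ.∣ E ∣
  p∣dE = subst (p ℕD.∣_) (ℤP.abs-* (+ d) E) (∣⇒∣ᵤ (∣-≡ (∣m⇒∣-m p∣H-dE) (negate (+ d) E)))

module BucketWidth (k p : ℕ) .{{_ : NonZero k}} .{{_ : NonZero p}} where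

  M : ℕ
  M = pred p / k

  p≤k*[1+M] : p ≤ k ℕ.* suc M
  p≤k*[1+M] = begin
    p                           ≡⟨ ℕP.suc-pred p ⟨
    suc (pred p)                ≡⟨ cong suc (m≡m%n+[m/n]*n (pred p) k) ⟩
    suc (pred p % k + M ℕ.* k)  ≤⟨ ℕP.+-monoˡ-≤ (M ℕ.* k) (m%n<n (pred p) k) ⟩
    suc M ℕ.* k                 ≡⟨ ℕP.*-comm (suc M) k ⟩
    k ℕ.* suc M                 ∎
    where open ℕP.≤-Reasoning

  k*M<p : k ℕ.* M < p
  k*M<p = begin-strict
    k ℕ.* M  ≡⟨ ℕP.*-comm k M ⟩
    M ℕ.* k  ≤⟨ m/n*n≤m (pred p) k ⟩
    pred p   <⟨ ℕP.≤-reflexive (ℕP.suc-pred p) ⟩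
    p        ∎
    where open ℕP.≤-Reasoning

  ≤M : ∀ K → k ℕ.* K < p → K ≤ M
  ≤M K kK<p = begin
    K              ≡⟨ m*n/n≡m K k ⟨
    K ℕ.* k / k    ≤⟨ /-monoˡ-≤ k (ℕP.<⇒≤pred (subst (_< p) (ℕP.*-comm k K) kK<p)) ⟩
    M              ∎
    where open ℕP.≤-Reasoning

sameBucket⇒close : ∀ M r r' → r / suc M ≡ r' / suc M → ℤ.∣ + r ℤ.- + r' ∣ ≤ M
sameBucket⇒close M r r' same = begin
  ℤ.∣ + r ℤ.- + r' ∣  ≡⟨ cong ℤ.∣_∣ (cong₂ ℤ._-_ (split r refl) (split r' (sym same))) ⟩
  ℤ.∣ (+ ρ ℤ.+ Q) ℤ.- (+ ρ' ℤ.+ Q) ∣  ≡⟨ cong ℤ.∣_∣ (cancel (+ ρ) (+ ρ') Q) ⟩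
  ℤ.∣ + ρ ℤ.- + ρ' ∣  ≡⟨ cong ℤ.∣_∣ (ℤP.[+m]-[+n]≡m⊖n ρ ρ') ⟩
  ℤ.∣ ρ ℤ.⊖ ρ' ∣      ≤⟨ ℤP.∣m⊝n∣≤m⊔n ρ ρ' ⟩
  ρ ℕ.⊔ ρ'            ≤⟨ ℕP.⊔-lub (ℕP.≤-pred (m%n<n r (suc M))) (ℕP.≤-pred (m%n<n r' (suc M))) ⟩
  M                   ∎
  where
  open ℕP.≤-Reasoning
  ρ = r % suc M
  ρ' = r' % suc M
  Q = + (r / suc M ℕ.* suc M)
  -- both residues share the bucket offset Q
  split : ∀ t → t / suc M ≡ r / suc M → + t ≡ + (t % suc M) ℤ.+ Q
  split t t≡r = trans (cong +_ (trans (m≡m%n+[m/n]*n t (suc M)) (cong (λ q → t % suc M + q ℕ.* suc M) t≡r)))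
                      (ℤP.pos-+ (t % suc M) _)
  cancel : ∀ a b q → (a ℤ.+ q) ℤ.- (b ℤ.+ q) ≡ a ℤ.- b
  cancel = solve-∀

residue-congruence : ∀ p .{{_ : NonZero p}} m → + p ∣ + (m % p) ℤ.- + m
residue-congruence p m = ∣-≡ (∣m⇒∣-m (∣n⇒∣m*n (+ (m / p)) ∣-refl)) (begin
  ℤ.- (+ (m / p) ℤ.* + p)                                ≡⟨ shift (+ (m % p)) (+ (m / p)) (+ p) ⟩
  + (m % p) ℤ.- (+ (m % p) ℤ.+ + (m / p) ℤ.* + p)         ≡⟨ cong (λ t → + (m % p) ℤ.- t) expand ⟨
  + (m % p) ℤ.- + m                                      ∎)
  where
  open ≡-Reasoning
  shift : ∀ r q P → ℤ.- (q ℤ.* P) ≡ r ℤ.- (r ℤ.+ q ℤ.* P)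
  shift = solve-∀
  expand : + m ≡ + (m % p) ℤ.+ + (m / p) ℤ.* + p
  expand = trans (cong +_ (m≡m%n+[m/n]*n m p))
                 (trans (ℤP.pos-+ (m % p) _) (cong (λ t → + (m % p) ℤ.+ t) (ℤP.pos-* (m / p) p)))

residue-difference : ∀ p .{{_ : NonZero p}} {u' u} A → u' ≤ u →
  + p ∣ (+ (u ℕ.* A % p) ℤ.- + (u' ℕ.* A % p)) ℤ.- + (u ∸ u') ℤ.* + A
residue-difference p {u'} {u} A u'≤u =
  ∣-≡ (∣m∣n⇒∣m-n (residue-congruence p (u ℕ.* A)) (residue-congruence p (u' ℕ.* A))) (begin
    (ρ ℤ.- + (u ℕ.* A)) ℤ.- (ρ' ℤ.- + (u' ℕ.* A))  ≡⟨ cong₂ (λ s t → (ρ ℤ.- s) ℤ.- (ρ' ℤ.- t)) (ℤP.pos-* u A) (ℤP.pos-* u' A) ⟩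
    (ρ ℤ.- + u ℤ.* + A) ℤ.- (ρ' ℤ.- + u' ℤ.* + A)  ≡⟨ regroup ρ ρ' (+ u) (+ u') (+ A) ⟩
    (ρ ℤ.- ρ') ℤ.- (+ u ℤ.- + u') ℤ.* + A         ≡⟨ cong (λ δ → (ρ ℤ.- ρ') ℤ.- δ ℤ.* + A) difference ⟨
    (ρ ℤ.- ρ') ℤ.- + (u ∸ u') ℤ.* + A             ∎)
  where
  open ≡-Reasoning
  ρ = + (u ℕ.* A % p)
  ρ' = + (u' ℕ.* A % p)
  regroup : ∀ ρ ρ' U U' A → (ρ ℤ.- U ℤ.* A) ℤ.- (ρ' ℤ.- U' ℤ.* A) ≡ (ρ ℤ.- ρ') ℤ.- (U ℤ.- U') ℤ.* A
  regroup = solve-∀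
  difference : + (u ∸ u') ≡ + u ℤ.- + u'
  difference = sym (trans (ℤP.[+m]-[+n]≡m⊖n u u') (ℤP.⊖-≥ u'≤u))

record Approximation (p D M n : ℕ) (a : Fin n → ℕ) : Set where
  field
    d : ℕ
    0<d : 0 < d
    d≤D : d ≤ D
    y : Fin n → ℤ
    y-small : ∀ i → ℤ.∣ y i ∣ ≤ M
    y≡da : ∀ i → + p ∣ y i ℤ.- + d ℤ.* + a i

collision⇒approximation : ∀ p D M n .{{_ : NonZero p}} (a : Fin n → ℕ) {u' u} → u' < u → u ≤ D →
  (∀ i → (u' ℕ.* a i % p) / suc M ≡ (u ℕ.* a i % p) / suc M) → Approximation p D M n a
collision⇒approximation p D M n a {u'} {u} u'<u u≤D same = record
  { d = u ∸ u'
  ; 0<d = ℕP.m<n⇒0<n∸m u'<u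
  ; d≤D = ℕP.≤-trans (ℕP.m∸n≤m u u') u≤D
  ; y = λ i → + (u ℕ.* a i % p) ℤ.- + (u' ℕ.* a i % p)
  ; y-small = λ i → sameBucket⇒close M (u ℕ.* a i % p) (u' ℕ.* a i % p) (sym (same i))
  ; y≡da = λ i → residue-difference p (a i) (ℕP.<⇒≤ u'<u)
  }

module _ (k M p n : ℕ) .{{_ : NonZero p}} (p≤k[1+M] : p ≤ k ℕ.* suc M) (a : Fin n → ℕ) where

  bucket : ℕ → Fin n → Fin k
  bucket u i = Fin.fromℕ< (m<n*o⇒m/o<n (ℕP.<-≤-trans (m%n<n (u ℕ.* a i) p) p≤k[1+M]))

  signature : Fin (suc (k ^ n)) → Fin (k ^ n)
  signature u = Fin.funToFin (bucket (Fin.toℕ u))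

  dirichlet : Approximation p (k ^ n) M n a
  dirichlet with FinP.pigeonhole (ℕP.n<1+n (k ^ n)) signature
  ... | u' , u , u'<u , same-signature =
    collision⇒approximation p (k ^ n) M n a u'<u (ℕP.≤-pred (FinP.toℕ<n u)) same
    where
    same-bucket : ∀ i → bucket (Fin.toℕ u') i ≡ bucket (Fin.toℕ u) i
    same-bucket i = trans (sym (FinP.finToFun-funToFin (bucket (Fin.toℕ u')) i))
      (trans (cong (λ s → Fin.finToFun s i) same-signature)
             (FinP.finToFun-funToFin (bucket (Fin.toℕ u)) i))
    same : ∀ i → (Fin.toℕ u' ℕ.* a i % p) / suc M ≡ (Fin.toℕ u ℕ.* a i % p) / suc M
    same i = trans (sym (FinP.toℕ-fromℕ< _)) (trans (cong Fin.toℕ (same-bucket i)) (FinP.toℕ-fromℕ< _))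

toℚᵘ-≃ : ∀ q x → ℚ.↥ q ℤ.* ℚᵘ.↧ x ≡ ℚᵘ.↥ x ℤ.* ℚ.↧ q → ℚ.toℚᵘ q ≃ x
toℚᵘ-≃ (ℚ.mkℚ _ _ _) x eq = *≡* eq

toℚᵘ-/ : ∀ i n .{{_ : NonZero n}} → ℚ.toℚᵘ (ℚ._/_ i n) ≃ ℚᵘ._/_ i n
toℚᵘ-/ i n@(suc _) = toℚᵘ-≃ q (ℚᵘ._/_ i n) (begin
  ↥q ℤ.* + n            ≡⟨ cong (↥q ℤ.*_) (ℚP.↧-/ i n) ⟨
  ↥q ℤ.* (↧q ℤ.* g)     ≡⟨ rotate ↥q ↧q g ⟩
  (↥q ℤ.* g) ℤ.* ↧q     ≡⟨ cong (ℤ._* ↧q) (ℚP.↥-/ i n) ⟩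
  i ℤ.* ↧q              ∎)
  where
  open ≡-Reasoning
  q = ℚ._/_ i n
  ↥q = ℚ.↥ q
  ↧q = ℚ.↧ q
  g = gcd i (+ n)
  rotate : ∀ a b c → a ℤ.* (b ℤ.* c) ≡ (a ℤ.* c) ℤ.* b
  rotate = solve-∀

/ᵘ-* : ∀ a b d .{{_ : NonZero d}} → ℚᵘ._/_ a 1 ℚᵘ.* ℚᵘ._/_ b d ≃ ℚᵘ._/_ (a ℤ.* b) d
/ᵘ-* a b (suc d) = *≡* (cong (λ z → (a ℤ.* b) ℤ.* + z) (sym (ℕP.*-identityˡ (suc d))))

/ᵘ-+ : ∀ a b d .{{_ : NonZero d}} → ℚᵘ._/_ a d ℚᵘ.+ ℚᵘ._/_ b d ≃ ℚᵘ._/_ (a ℤ.+ b) d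
/ᵘ-+ a b (suc d) = *≡* (trans (regroup a b (+ suc d)) (cong ((a ℤ.+ b) ℤ.*_) (ℤP.pos-* (suc d) (suc d))))
  where
  regroup : ∀ a b D → (a ℤ.* D ℤ.+ b ℤ.* D) ℤ.* D ≡ (a ℤ.+ b) ℤ.* (D ℤ.* D)
  regroup = solve-∀

/ᵘ-+-integer : ∀ a b d .{{_ : NonZero d}} → ℚᵘ._/_ a 1 ℚᵘ.+ ℚᵘ._/_ b d ≃ ℚᵘ._/_ (a ℤ.* + d ℤ.+ b) d
/ᵘ-+-integer a b (suc d) = *≡* (trans (regroup a b (+ suc d))
  (cong ((a ℤ.* + suc d ℤ.+ b) ℤ.*_) (cong +_ (sym (ℕP.*-identityˡ (suc d))))))
  where
  regroup : ∀ a b D → (a ℤ.* D ℤ.+ b ℤ.* + 1) ℤ.* D ≡ (a ℤ.* D ℤ.+ b) ℤ.* D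
  regroup = solve-∀

0≃0/ᵘ : ∀ d .{{_ : NonZero d}} → ℚ.toℚᵘ 0ℚ ≃ ℚᵘ._/_ (+ 0) d
0≃0/ᵘ (suc d) = *≡* refl

∑ℚ-/ : ∀ d .{{_ : NonZero d}} n (c y : Fin n → ℤ) →
  ℚ.toℚᵘ (∑ℚ n (λ i → ℚ._/_ (c i) 1 ℚ.* ℚ._/_ (y i) d)) ≃ ℚᵘ._/_ (∑ℤ n (λ i → c i ℤ.* y i)) d
∑ℚ-/ d zero c y = 0≃0/ᵘ d
∑ℚ-/ d (suc n) c y = begin
  ℚ.toℚᵘ (t₀ ℚ.+ T)                              ≈⟨ ℚP.toℚᵘ-homo-+ t₀ T ⟩
  ℚ.toℚᵘ t₀ ℚᵘ.+ ℚ.toℚᵘ T                        ≈⟨ ℚᵘP.+-cong head (∑ℚ-/ d n (c ∘ Fin.suc) (y ∘ Fin.suc)) ⟩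
  ℚᵘ._/_ (c₀ ℤ.* y₀) d ℚᵘ.+ ℚᵘ._/_ S d           ≈⟨ /ᵘ-+ (c₀ ℤ.* y₀) S d ⟩
  ℚᵘ._/_ (c₀ ℤ.* y₀ ℤ.+ S) d                     ∎
  where
  open ℚᵘP.≃-Reasoning
  c₀ = c Fin.zero
  y₀ = y Fin.zero
  t₀ = ℚ._/_ c₀ 1 ℚ.* ℚ._/_ y₀ d
  T = ∑ℚ n (λ i → ℚ._/_ (c (Fin.suc i)) 1 ℚ.* ℚ._/_ (y (Fin.suc i)) d)
  S = ∑ℤ n (λ i → c (Fin.suc i) ℤ.* y (Fin.suc i))
  head : ℚ.toℚᵘ t₀ ≃ ℚᵘ._/_ (c₀ ℤ.* y₀) d
  head = begin
    ℚ.toℚᵘ t₀                                    ≈⟨ ℚP.toℚᵘ-homo-* (ℚ._/_ c₀ 1) (ℚ._/_ y₀ d) ⟩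
    ℚ.toℚᵘ (ℚ._/_ c₀ 1) ℚᵘ.* ℚ.toℚᵘ (ℚ._/_ y₀ d) ≈⟨ ℚᵘP.*-cong (toℚᵘ-/ c₀ 1) (toℚᵘ-/ y₀ d) ⟩
    ℚᵘ._/_ c₀ 1 ℚᵘ.* ℚᵘ._/_ y₀ d                 ≈⟨ /ᵘ-* c₀ y₀ d ⟩
    ℚᵘ._/_ (c₀ ℤ.* y₀) d                         ∎

evalℚ-/ : ∀ {n} d .{{_ : NonZero d}} (f : LinPoly n) (y : Fin n → ℤ) →
  evalℚ f (λ i → ℚ._/_ (y i) d) ≡ ℚ._/_ (homEval f d y) d
evalℚ-/ {n} d f y = ℚP.toℚᵘ-injective (begin
  ℚ.toℚᵘ (ℚ._/_ (const f) 1 ℚ.+ T)                   ≈⟨ ℚP.toℚᵘ-homo-+ (ℚ._/_ (const f) 1) T ⟩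
  ℚ.toℚᵘ (ℚ._/_ (const f) 1) ℚᵘ.+ ℚ.toℚᵘ T           ≈⟨ ℚᵘP.+-cong (toℚᵘ-/ (const f) 1) (∑ℚ-/ d n (coeff f) y) ⟩
  ℚᵘ._/_ (const f) 1 ℚᵘ.+ ℚᵘ._/_ S d                 ≈⟨ /ᵘ-+-integer (const f) S d ⟩
  ℚᵘ._/_ (homEval f d y) d                           ≈⟨ toℚᵘ-/ (homEval f d y) d ⟨
  ℚ.toℚᵘ (ℚ._/_ (homEval f d y) d)                   ∎)
  where
  open ℚᵘP.≃-Reasoning
  T = ∑ℚ n (λ i → ℚ._/_ (coeff f i) 1 ℚ.* ℚ._/_ (y i) d)
  S = ∑ℤ n (λ i → coeff f i ℤ.* y i)

/≡0⇒≡0 : ∀ H d .{{_ : NonZero d}} → ℚ._/_ H d ≡ 0ℚ → H ≡ + 0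
/≡0⇒≡0 H d H/d≡0 = begin
  H                                    ≡⟨ ℚP.↥-/ H d ⟨
  ℚ.↥ (ℚ._/_ H d) ℤ.* gcd H (+ d)      ≡⟨ cong (ℤ._* gcd H (+ d)) (ℚP.p≡0⇒↥p≡0 _ H/d≡0) ⟩
  + 0                                  ∎
  where open ≡-Reasoning

denominator-/ : ∀ y d .{{_ : NonZero d}} → ℚ.denominatorℕ (ℚ._/_ y d) ℕ.* ℤ.∣ gcd y (+ d) ∣ ≡ d
denominator-/ y d = trans (sym (ℤP.abs-* (ℚ.↧ (ℚ._/_ y d)) (gcd y (+ d)))) (cong ℤ.∣_∣ (ℚP.↧-/ y d))

/-inLocalization : ∀ p y d .{{_ : NonZero d}} → ¬ p ℕD.∣ d → InLocalization p (ℚ._/_ y d)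
/-inLocalization p y d p∤d p∣den =
  p∤d (subst (p ℕD.∣_) (denominator-/ y d) (ℕD.∣m⇒∣m*n ℤ.∣ gcd y (+ d) ∣ p∣den))

/-mapsTo : ∀ {p} → Prime p → ∀ y d .{{_ : NonZero d}} (a : Fin p) → ¬ p ℕD.∣ d →
  + p ∣ y ℤ.- + d ℤ.* + Fin.toℕ a → MapsTo p (ℚ._/_ y d) a
/-mapsTo {p} pr y d a p∤d y≡da = [ id , ⊥-elim ∘ p∤g ]′ (euclidsLemma ℤ.∣ X ∣ ℤ.∣ g ∣ pr p∣Xg)
  where
  open ≡-Reasoning
  q = ℚ._/_ y d
  g = gcd y (+ d)
  A = + Fin.toℕ a
  X = ℚ.↥ q ℤ.- A ℤ.* ℚ.↧ q
  distribute : ∀ N D A g → (N ℤ.- A ℤ.* D) ℤ.* g ≡ N ℤ.* g ℤ.- A ℤ.* (D ℤ.* g)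
  distribute = solve-∀
  commute : ∀ y A D → y ℤ.- A ℤ.* D ≡ y ℤ.- D ℤ.* A
  commute = solve-∀
  -- clearing the cancelled gcd turns the numerator of q - a back into y - d·a
  cleared : X ℤ.* g ≡ y ℤ.- + d ℤ.* A
  cleared = begin
    X ℤ.* g                                 ≡⟨ distribute (ℚ.↥ q) (ℚ.↧ q) A g ⟩
    ℚ.↥ q ℤ.* g ℤ.- A ℤ.* (ℚ.↧ q ℤ.* g)     ≡⟨ cong₂ (λ s t → s ℤ.- A ℤ.* t) (ℚP.↥-/ y d) (ℚP.↧-/ y d) ⟩
    y ℤ.- A ℤ.* + d                         ≡⟨ commute y A (+ d) ⟩
    y ℤ.- + d ℤ.* A                         ∎
  p∣Xg : p ℕD.∣ ℤ.∣ X ∣ ℕ.* ℤ.∣ g ∣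
  p∣Xg = subst (p ℕD.∣_) (ℤP.abs-* X g) (∣⇒∣ᵤ (∣-≡ y≡da (sym cleared)))
  -- the cancelled gcd divides d, so p does not divide it
  p∤g : ¬ p ℕD.∣ ℤ.∣ g ∣
  p∤g p∣g = p∤d (subst (p ℕD.∣_) (denominator-/ y d) (ℕD.∣n⇒∣m*n (ℚ.denominatorℕ q) p∣g))

-- The theorem.
lemma6p2 : (k p n : ℕ) → 1 < k → Prime p →
    (a : Fin n → Fin p) → Injective _≡_ _≡_ a →
    (L₁ L₂ : LinPoly n → Set) →
    (∀ f → L₁ f → KBounded k f) → (∀ f → L₂ f → KBounded k f) →
    (∀ f → L₁ f → VanishesModP p f a) →
    (∀ f → L₂ f → ¬ VanishesModP p f a) →
    k ^ (n + 1) < p →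
    Σ (Fin n → ℚ) (λ b →
      (∀ i → InLocalization p (b i)) ×
      (∀ i → MapsTo p (b i) (a i)) ×
      (∀ f → L₁ f → evalℚ f b ≡ 0ℚ) ×
      (∀ f → L₂ f → evalℚ f b ≢ 0ℚ))
lemma6p2 k p n 1<k pr a _ L₁ L₂ bd₁ _ v₁ v₂ k^[n+1]<p = b , local , reduces , roots , nonroots
  where
  instance
    k≢0 : NonZero k
    k≢0 = >-nonZero (ℕP.<-trans ℕ.z<s 1<k)
    p≢0 : NonZero p
    p≢0 = prime⇒nonZero pr
  open BucketWidth k p
  open Approximation (dirichlet k M p n p≤k*[1+M] (Fin.toℕ ∘ a))
  instance
    d≢0 : NonZero d
    d≢0 = >-nonZero 0<d
  d≤M : d ≤ M
  d≤M = ℕP.≤-trans d≤D (≤M (k ^ n) (subst (_< p) (cong (k ^_) (ℕP.+-comm n 1)) k^[n+1]<p))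
  p∤d : ¬ p ℕD.∣ d
  p∤d = ℕD.>⇒∤ (ℕP.≤-<-trans d≤M (ℕP.≤-<-trans (ℕP.m≤n*m M k) k*M<p))
  b : Fin n → ℚ
  b i = ℚ._/_ (y i) d
  local : ∀ i → InLocalization p (b i)
  local i = /-inLocalization p (y i) d p∤d
  reduces : ∀ i → MapsTo p (b i) (a i)
  reduces i = /-mapsTo pr (y i) d (a i) p∤d (y≡da i)
  -- the integer d·f(b) is congruent to d·f(a) and, for k-bounded f, smaller than p
  f[a] : LinPoly n → ℤ
  f[a] f = evalℤ f (λ i → + Fin.toℕ (a i))
  congruent : ∀ f → + p ∣ homEval f d y ℤ.- + d ℤ.* f[a] f
  congruent f = homEval-congruence f d y _ y≡da
  small : ∀ f → KBounded k f → ℤ.∣ homEval f d y ∣ < p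
  small f bounded = ℕP.≤-<-trans (homEval-bound f y bounded d≤M y-small) k*M<p
  roots : ∀ f → L₁ f → evalℚ f b ≡ 0ℚ
  roots f f∈L₁ = begin
    evalℚ f b                 ≡⟨ evalℚ-/ d f y ⟩
    ℚ._/_ (homEval f d y) d   ≡⟨ cong (λ H → ℚ._/_ H d) H≡0 ⟩
    ℚ._/_ (+ 0) d             ≡⟨ ℚP.0/n≡0 d ⟩
    0ℚ                        ∎
    where
    open ≡-Reasoning
    H≡0 = small-congruent-zero d (homEval f d y) (f[a] f) (congruent f) (small f (bd₁ f f∈L₁)) (v₁ f f∈L₁)
  nonroots : ∀ f → L₂ f → evalℚ f b ≢ 0ℚ
  nonroots f f∈L₂ f[b]≡0 = v₂ f f∈L₂ (zero-congruent⇒∣ d (homEval f d y) (f[a] f) pr p∤d (congruent f) H≡0)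
    where H≡0 = /≡0⇒≡0 (homEval f d y) d (trans (sym (evalℚ-/ d f y)) f[b]≡0)
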